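{- Let $m\geq0$ and $n\geq1$ be integers and let $(a_{ij})_{1\leq i,j\leq 2(n+m)}$ be (the height array of) an element of $\mathcal{S}_{n,m}$. Associate to it the triangular array $\big(a_{i+1,j+1}-(n+2m)\big)_{1\leq i\leq j\leq n+m-1}$. Then this triangular array belongs to $\mathcal{T}_{n,m}$, and this map $\mathcal{S}_{n,m}\to\mathcal{T}_{n,m}$ is a bijection.
   Context: A plane partition is identified with its Ferrers graph, a finite set $\pi\subset\mathbb{P}^3$ ($\mathbb{P}$ the positive integers) such that $(x_2,y_2,z_2)\in\pi$ and $x_1\le x_2,y_1\le y_2,z_1\le z_2$ imply $(x_1,y_1,z_1)\in\pi$; its height array is $a_{ij}=\#\{z:(i,j,z)\in\pi\}$. Let $M=n+m$. A totally symmetric self-complementary plane partition of size $M$ is a plane partition $\pi\subseteq[2M]^3$ invariant under all permutations of the coordinates and such that for every $(x,y,z)\in[2M]^3$, $(x,y,z)\in\pi$ iff $(2M+1-x,2M+1-y,2M+1-z)\notin\pi$. $\mathcal{S}_{n,m}$ is the set of such $\pi$ satisfying: every $(x,y,z)\in\pi$ with $n+1\leq x,y,z\leq n+2m$ has at least two of its coordinates $\leq n+m$. $\mathcal{T}_{n,m}$ is the set of arrays $b=(b_{ij})_{1\leq i\leq j\leq n+m-1}$ of integers, weakly decreasing along rows and columns ($b_{ij}\ge b_{i,j+1}$, $b_{ij}\ge b_{i+1,j}$ whenever defined), with $\max\{n-i,0\}\leq b_{ij}\leq n$. -}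

module Defs where

open import Data.Nat using (ℕ; zero; suc; _+_; _*_; _∸_; _≤_; _<_)
open import Data.Bool using (Bool; true; false; not; if_then_else_)
open import Data.Integer as ℤ using (ℤ; +_)
open import Data.Product using (_×_; Σ; ∃; _,_)
open import Data.Sum using (_⊎_)
open import Relation.Binary.PropositionalEquality using (_≡_)

-- A candidate Ferrers graph: the characteristic function of a subset of ℕ³.
-- Coordinates are 1-based (ℙ = positive integers); π x y z ≡ true means (x,y,z) ∈ π.
Triples : Set
Triples = ℕ → ℕ → ℕ → Bool

InBox : ℕ → Triples → Set
InBox N π = ∀ x y z → π x y z ≡ true →
  (1 ≤ x × x ≤ N) × (1 ≤ y × y ≤ N) × (1 ≤ z × z ≤ N)

IsDownClosed : Triples → Set
IsDownClosed π = ∀ x₁ y₁ z₁ x₂ y₂ z₂ → π x₂ y₂ z₂ ≡ true →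
  1 ≤ x₁ → 1 ≤ y₁ → 1 ≤ z₁ → x₁ ≤ x₂ → y₁ ≤ y₂ → z₁ ≤ z₂ →
  π x₁ y₁ z₁ ≡ true

IsPlanePartitionIn : ℕ → Triples → Set
IsPlanePartitionIn N π = InBox N π × IsDownClosed π

IsTotallySymmetric : Triples → Set
IsTotallySymmetric π = ∀ x y z →
  (π x y z ≡ π y x z) × (π x y z ≡ π x z y) × (π x y z ≡ π z y x) ×
  (π x y z ≡ π y z x) × (π x y z ≡ π z x y)

IsSelfComplementary : ℕ → Triples → Set
IsSelfComplementary N π = ∀ x y z →
  1 ≤ x → x ≤ N → 1 ≤ y → y ≤ N → 1 ≤ z → z ≤ N →
  π x y z ≡ not (π (suc N ∸ x) (suc N ∸ y) (suc N ∸ z))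

IsTSSCPP : ℕ → Triples → Set
IsTSSCPP M π = IsPlanePartitionIn (2 * M) π × IsTotallySymmetric π
             × IsSelfComplementary (2 * M) π

AtLeastTwoLe : ℕ → ℕ → ℕ → ℕ → Set
AtLeastTwoLe k x y z = (x ≤ k × y ≤ k) ⊎ (x ≤ k × z ≤ k) ⊎ (y ≤ k × z ≤ k)

InS : ℕ → ℕ → Triples → Set
InS n m π = IsTSSCPP (n + m) π ×
  (∀ x y z → π x y z ≡ true →
     suc n ≤ x → x ≤ n + 2 * m →
     suc n ≤ y → y ≤ n + 2 * m →
     suc n ≤ z → z ≤ n + 2 * m →
     AtLeastTwoLe (n + m) x y z)

countUpTo : (ℕ → Bool) → ℕ → ℕ
countUpTo p zero = 0
countUpTo p (suc K) = (if p (suc K) then 1 else 0) + countUpTo p K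

heights : ℕ → Triples → ℕ → ℕ → ℕ
heights N π i j = countUpTo (π i j) N

-- triangular arrays are functions ℕ → ℕ → ℤ, only entries 1 ≤ i ≤ j ≤ M-1 matter
TriArray : Set
TriArray = ℕ → ℕ → ℤ

InTri : ℕ → ℕ → ℕ → Set
InTri K i j = 1 ≤ i × i ≤ j × j ≤ K

InT : ℕ → ℕ → TriArray → Set
InT n m b =
  (∀ i j → InTri K i j → InTri K i (suc j) → b i (suc j) ℤ.≤ b i j) ×
  (∀ i j → InTri K i j → InTri K (suc i) j → b (suc i) j ℤ.≤ b i j) ×
  (∀ i j → InTri K i j → (+ (n ∸ i) ℤ.≤ b i j) × (b i j ℤ.≤ + n))
  where K = n + m ∸ 1

toTri : ℕ → ℕ → Triples → TriArray
toTri n m π i j = + heights (2 * (n + m)) π (suc i) (suc j) ℤ.- + (n + 2 * m)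

{-# OPTIONS --safe #-}
module Submission where

-- A TSSCPP π of size M = n + m is determined by its heights A x y = #{z : (x,y,z) ∈ π} on the
-- quadrant [M]²: by total symmetry every point with two coordinates ≤ M is decided by such a
-- height, and by self-complementarity every other point of [2M]³ is the complement of one that
-- is. These heights form a symmetric array, weakly decreasing in each index, bounded by 2M and
-- with A u v ≥ 2M + 1 − u, because (u, v, 2M + 1 − u) lies in π for v ≤ M. Conversely every such
-- array is the height array of a TSSCPP; the lower bound is exactly what makes the glued set
-- down-closed across the middle plane z = M. For π ∈ 𝒮_{n,m} the defining condition amounts to
-- A ≥ n + 2m on [M]², the first row is forced to be 2M, and subtracting n + 2m from the entries
-- A (i+1) (j+1) with 1 ≤ i ≤ j turns the conditions on A into those defining 𝒯_{n,m}.

open import Defs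
open import Data.Bool using (Bool; true; false; not; _∧_; if_then_else_)
open import Data.Bool.Properties
  using (T-≡; not-¬; ¬-not; not-injective; not-involutive; ∧-comm; ∧-assoc)
open import Data.Empty using (⊥; ⊥-elim)
open import Data.Integer as ℤ using (ℤ; +_)
import Data.Integer.Properties as ℤ
open import Algebra.Properties.AbelianGroup ℤ.+-0-abelianGroup using (∙-cancelʳ)
open import Data.Nat
  using (ℕ; zero; suc; _+_; _*_; _∸_; _⊓_; _⊔_; _≤_; _<_; _≤ᵇ_; _≤?_; z≤n; s≤s)
open import Data.Nat.Properties
open import Data.Nat.Tactic.RingSolver using (solve-∀)
open import Data.Product using (_×_; Σ; _,_; proj₁; proj₂)
open import Data.Sum using (_⊎_; inj₁; inj₂)
open import Function.Bundles using (_⇔_; mk⇔; module Equivalence)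
open import Function.Construct.Composition using (_⇔-∘_)
open import Function.Construct.Symmetry using (⇔-sym)
open import Relation.Binary.Definitions using (tri<; tri≈; tri>)
open import Relation.Binary.PropositionalEquality
open import Relation.Nullary using (yes; no)

open Equivalence using (to; from)

≤ᵇ⇔≤ : ∀ {m n} → (m ≤ᵇ n) ≡ true ⇔ m ≤ n
≤ᵇ⇔≤ {m} {n} = mk⇔ (λ eq → ≤ᵇ⇒≤ m n (from T-≡ eq)) (λ m≤n → to T-≡ (≤⇒≤ᵇ m≤n))

≤ᵇ-false : ∀ {m n} → n < m → (m ≤ᵇ n) ≡ false
≤ᵇ-false n<m = ¬-not (λ eq → <⇒≱ n<m (to ≤ᵇ⇔≤ eq))

not-≤ᵇ⇔> : ∀ {m n} → not (m ≤ᵇ n) ≡ true ⇔ n < m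
not-≤ᵇ⇔> = mk⇔ (λ eq → ≰⇒> (λ m≤n → not-¬ (from ≤ᵇ⇔≤ m≤n) (not-injective eq)))
               (λ n<m → cong not (≤ᵇ-false n<m))

∧-≡-true : ∀ {a b} → a ∧ b ≡ true → a ≡ true × b ≡ true
∧-≡-true {true} b≡true = refl , b≡true

≡-from-⇔ : ∀ {a b : Bool} → a ≡ true ⇔ b ≡ true → a ≡ b
≡-from-⇔ {false} {false} _   = refl
≡-from-⇔ {true}  {true}  _   = refl
≡-from-⇔ {false} {true}  a⇔b = from a⇔b refl
≡-from-⇔ {true}  {false} a⇔b = sym (to a⇔b refl)

≡not⇒true : ∀ {a b} → a ≡ not b → (b ≡ true → a ≡ true) → a ≡ true
≡not⇒true {b = false} a≡true _   = a≡true
≡not⇒true {b = true}  _      b⇒a = b⇒a refl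

infix 4 _∈[_]
_∈[_] : ℕ → ℕ → Set
x ∈[ K ] = 1 ≤ x × x ≤ K

DownClosed : (ℕ → Bool) → Set
DownClosed p = ∀ {z₁ z₂} → 1 ≤ z₁ → z₁ ≤ z₂ → p z₂ ≡ true → p z₁ ≡ true

countUpTo-≤ : ∀ p K → countUpTo p K ≤ K
countUpTo-≤ p zero = z≤n
countUpTo-≤ p (suc K) with p (suc K)
... | true  = s≤s (countUpTo-≤ p K)
... | false = m≤n⇒m≤1+n (countUpTo-≤ p K)

countUpTo-mono : ∀ {p q} K → (∀ {z} → p z ≡ true → q z ≡ true) →
                 countUpTo p K ≤ countUpTo q K
countUpTo-mono zero p⇒q = z≤n
countUpTo-mono {p} {q} (suc K) p⇒q with p (suc K) in p[K+1] | q (suc K) in q[K+1]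
... | true  | true  = s≤s (countUpTo-mono K p⇒q)
... | true  | false with () ← trans (sym (p⇒q p[K+1])) q[K+1]
... | false | true  = m≤n⇒m≤1+n (countUpTo-mono K p⇒q)
... | false | false = countUpTo-mono K p⇒q

countUpTo-cong : ∀ {p q} K → (∀ z → p z ≡ q z) → countUpTo p K ≡ countUpTo q K
countUpTo-cong zero    p≗q = refl
countUpTo-cong (suc K) p≗q =
  cong₂ (λ b c → (if b then 1 else 0) + c) (p≗q (suc K)) (countUpTo-cong K p≗q)

countUpTo-initial : ∀ {p h} K → (∀ {z} → z ∈[ K ] → p z ≡ true ⇔ z ≤ h) →
                    countUpTo p K ≡ h ⊓ K
countUpTo-initial {h = h} zero _ = sym (⊓-zeroʳ h)
countUpTo-initial {p} {h} (suc K) spec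
  with countUpTo-initial K (λ (1≤z , z≤K) → spec (1≤z , m≤n⇒m≤1+n z≤K))
     | p (suc K) in p[K+1] | suc K ≤? h
... | ih | true  | yes K<h = begin
  suc (countUpTo p K) ≡⟨ cong suc ih ⟩
  suc (h ⊓ K)         ≡⟨ cong suc (m≥n⇒m⊓n≡n (<⇒≤ K<h)) ⟩
  suc K               ≡⟨ m≥n⇒m⊓n≡n K<h ⟨
  h ⊓ suc K           ∎
  where open ≡-Reasoning
... | _  | true  | no  K≮h = ⊥-elim (K≮h (to (spec (s≤s z≤n , ≤-refl)) p[K+1]))
... | _  | false | yes K<h with () ← trans (sym p[K+1]) (from (spec (s≤s z≤n , ≤-refl)) K<h)
... | ih | false | no  K≮h = begin
  countUpTo p K ≡⟨ ih ⟩
  h ⊓ K         ≡⟨ m≤n⇒m⊓n≡m h≤K ⟩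
  h             ≡⟨ m≤n⇒m⊓n≡m (m≤n⇒m≤1+n h≤K) ⟨
  h ⊓ suc K     ∎
  where
  open ≡-Reasoning
  h≤K = ≤-pred (≰⇒> K≮h)

countUpTo-downClosed : ∀ {p} → DownClosed p → ∀ K {z} → z ∈[ K ] →
                       p z ≡ true ⇔ z ≤ countUpTo p K
countUpTo-downClosed dc zero (1≤z , z≤0) = ⊥-elim (<⇒≱ 1≤z z≤0)
countUpTo-downClosed {p} dc (suc K) {z} (1≤z , z≤K+1) with p (suc K) in p[K+1]
... | true = mk⇔ (λ _ → subst (z ≤_) (cong suc (sym allTrue)) z≤K+1)
                (λ _ → dc 1≤z z≤K+1 p[K+1])
  where
  allTrue : countUpTo p K ≡ K
  allTrue = trans (countUpTo-initial K λ (1≤w , w≤K) →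
                     mk⇔ (λ _ → w≤K) (λ _ → dc 1≤w (m≤n⇒m≤1+n w≤K) p[K+1]))
                  (⊓-idem K)
... | false with z ≤? K
...   | yes z≤K = countUpTo-downClosed dc K (1≤z , z≤K)
...   | no  z≰K =
  mk⇔ (λ pz → ⊥-elim (not-¬ (subst (λ w → p w ≡ true) z≡K+1 pz) p[K+1]))
      (λ z≤count → ⊥-elim (z≰K (≤-trans z≤count (countUpTo-≤ p K))))
  where z≡K+1 = ≤-antisym z≤K+1 (≰⇒> z≰K)

module FromSwaps {π : Triples} (swap₁₂ : ∀ x y z → π x y z ≡ π y x z)
                               (swap₂₃ : ∀ x y z → π x y z ≡ π x z y) where

  swap₁₃ : ∀ x y z → π x y z ≡ π z y x
  swap₁₃ x y z = trans (swap₁₂ x y z) (trans (swap₂₃ y x z) (swap₁₂ y z x))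

  totallySymmetric : IsTotallySymmetric π
  totallySymmetric x y z =
    swap₁₂ x y z , swap₂₃ x y z , swap₁₃ x y z ,
    trans (swap₁₂ x y z) (swap₂₃ y x z) , trans (swap₂₃ x y z) (swap₁₂ x z y)

  downClosed-from-steps : (∀ x y z → 1 ≤ z → π x y (suc z) ≡ true → π x y z ≡ true) →
                          IsDownClosed π
  downClosed-from-steps step x₁ y₁ z₁ x₂ y₂ z₂ e 1≤x₁ 1≤y₁ 1≤z₁ x₁≤x₂ y₁≤y₂ z₁≤z₂ =
    trans (swap₁₃ x₁ y₁ z₁) (lower 1≤x₁ x₁≤x₂ (trans (sym (swap₁₃ x₂ y₁ z₁)) e₂))
    where
    lower : ∀ {x y} → DownClosed (π x y)
    lower         {z₂ = zero}  1≤a a≤0 _ = ⊥-elim (<⇒≱ 1≤a a≤0)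
    lower {x} {y} {z₂ = suc b} 1≤a a≤b+1 e with m≤n⇒m<n∨m≡n a≤b+1
    ... | inj₂ refl       = e
    ... | inj₁ (s≤s a≤b) = lower 1≤a a≤b (step x y b (≤-trans 1≤a a≤b) e)
    e₂ : π x₂ y₁ z₁ ≡ true
    e₂ = trans (swap₂₃ x₂ y₁ z₁)
               (lower 1≤y₁ y₁≤y₂ (trans (sym (swap₂₃ x₂ y₂ z₁)) (lower 1≤z₁ z₁≤z₂ e)))

AtLeastTwo : (ℕ → Set) → ℕ → ℕ → ℕ → Set
AtLeastTwo P x y z = (P x × P y) ⊎ (P x × P z) ⊎ (P y × P z)

AtLeastTwo-map : ∀ {P Q : ℕ → Set} → (∀ {x} → P x → Q x) →
                 ∀ {x y z} → AtLeastTwo P x y z → AtLeastTwo Q x y z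
AtLeastTwo-map f (inj₁ (px , py))        = inj₁ (f px , f py)
AtLeastTwo-map f (inj₂ (inj₁ (px , pz))) = inj₂ (inj₁ (f px , f pz))
AtLeastTwo-map f (inj₂ (inj₂ (py , pz))) = inj₂ (inj₂ (f py , f pz))

symmetrize : (ℕ → ℕ → ℕ) → ℕ → ℕ → ℕ
symmetrize f u v = if u ≤ᵇ v then f u v else f v u

symmetrize-≤ : ∀ f {u v} → u ≤ v → symmetrize f u v ≡ f u v
symmetrize-≤ f u≤v rewrite from ≤ᵇ⇔≤ u≤v = refl

symmetrize-≥ : ∀ f {u v} → v ≤ u → symmetrize f u v ≡ f v u
symmetrize-≥ f {u} {v} v≤u with u ≤ᵇ v in u≤ᵇv
... | true  = subst (λ w → f u w ≡ f w u) (≤-antisym (to ≤ᵇ⇔≤ u≤ᵇv) v≤u) refl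
... | false = refl

symmetrize-sym : ∀ f u v → symmetrize f u v ≡ symmetrize f v u
symmetrize-sym f u v with ≤-total u v
... | inj₁ u≤v = trans (symmetrize-≤ f u≤v) (sym (symmetrize-≥ f u≤v))
... | inj₂ v≤u = trans (symmetrize-≥ f v≤u) (sym (symmetrize-≤ f v≤u))

module Cube (M : ℕ) where

  N : ℕ
  N = 2 * M

  co : ℕ → ℕ
  co x = suc N ∸ x

  Low High : ℕ → Set
  Low  x = x ∈[ M ]
  High x = M < x × x ≤ N

  InCube : ℕ → ℕ → ℕ → Set
  InCube x y z = x ∈[ N ] × y ∈[ N ] × z ∈[ N ]

  M≤N : M ≤ N
  M≤N = m≤m+n M (M + 0)

  N∸M≡M : N ∸ M ≡ M
  N∸M≡M = trans (m+n∸m≡n M (M + 0)) (+-identityʳ M)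

  co-involutive : ∀ {x} → x ≤ suc N → co (co x) ≡ x
  co-involutive = m∸[m∸n]≡n

  co-antitone : ∀ {x y} → x ≤ y → co y ≤ co x
  co-antitone = ∸-monoʳ-≤ (suc N)

  co-suc : ∀ {z} → z ≤ N → co z ≡ suc (co (suc z))
  co-suc = +-∸-assoc 1

  co-∈ : ∀ {x} → x ∈[ N ] → co x ∈[ N ]
  co-∈ {x} (1≤x , x≤N) = subst (_≤ co x) (m+n∸n≡m 1 N) (co-antitone x≤N) , co-antitone 1≤x

  co-Low : ∀ {x} → Low x → High (co x)
  co-Low {x} (1≤x , x≤M) = subst (_≤ co x) coM≡1+M (co-antitone x≤M) , co-antitone 1≤x
    where coM≡1+M = trans (co-suc M≤N) (cong suc N∸M≡M)

  co-High : ∀ {x} → High x → Low (co x)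
  co-High {x} (M<x , x≤N) = proj₁ (co-∈ (≤-trans (s≤s z≤n) M<x , x≤N)) ,
                            subst (co x ≤_) N∸M≡M (co-antitone M<x)

  Low⇒∈ : ∀ {x} → Low x → x ∈[ N ]
  Low⇒∈ (1≤x , x≤M) = 1≤x , ≤-trans x≤M M≤N

  High⇒∈ : ∀ {x} → High x → x ∈[ N ]
  High⇒∈ (M<x , x≤N) = ≤-trans (s≤s z≤n) M<x , x≤N

  Low⊎High : ∀ {x} → x ∈[ N ] → Low x ⊎ High x
  Low⊎High {x} (1≤x , x≤N) with x ≤? M
  ... | yes x≤M = inj₁ (1≤x , x≤M)
  ... | no  x≰M = inj₂ (≰⇒> x≰M , x≤N)

  twoLow⊎twoHigh : ∀ {x y z} → InCube x y z → AtLeastTwo Low x y z ⊎ AtLeastTwo High x y z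
  twoLow⊎twoHigh (x∈ , y∈ , z∈) with Low⊎High x∈ | Low⊎High y∈ | Low⊎High z∈
  ... | inj₁ lx | inj₁ ly | _       = inj₁ (inj₁ (lx , ly))
  ... | inj₁ lx | inj₂ _  | inj₁ lz = inj₁ (inj₂ (inj₁ (lx , lz)))
  ... | inj₂ _  | inj₁ ly | inj₁ lz = inj₁ (inj₂ (inj₂ (ly , lz)))
  ... | inj₁ _  | inj₂ hy | inj₂ hz = inj₂ (inj₂ (inj₂ (hy , hz)))
  ... | inj₂ hx | inj₁ _  | inj₂ hz = inj₂ (inj₂ (inj₁ (hx , hz)))
  ... | inj₂ hx | inj₂ hy | _       = inj₂ (inj₁ (hx , hy))

  co-twoHigh : ∀ {x y z} → AtLeastTwo High x y z → AtLeastTwo Low (co x) (co y) (co z)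
  co-twoHigh (inj₁ (hx , hy))        = inj₁ (co-High hx , co-High hy)
  co-twoHigh (inj₂ (inj₁ (hx , hz))) = inj₂ (inj₁ (co-High hx , co-High hz))
  co-twoHigh (inj₂ (inj₂ (hy , hz))) = inj₂ (inj₂ (co-High hy , co-High hz))

  record IsHeightArray (A : ℕ → ℕ → ℕ) : Set where
    field
      symmetric : ∀ u v → A u v ≡ A v u
      antitone  : ∀ {u v} → Low u → Low v → suc v ≤ M → A u (suc v) ≤ A u v
      bounded   : ∀ {u v} → Low u → Low v → A u v ≤ N
      co≤       : ∀ {u v} → Low u → Low v → co u ≤ A u v

    antitoneˡ : ∀ {u v} → Low u → Low v → suc u ≤ M → A (suc u) v ≤ A u v
    antitoneˡ {u} {v} lu lv u<M =
      subst₂ _≤_ (symmetric v (suc u)) (symmetric v u) (antitone lv lu u<M)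

    firstRow : ∀ {v} → Low v → A 1 v ≡ N
    firstRow lv@(1≤v , v≤M) = ≤-antisym (bounded l1 lv) (co≤ l1 lv)
      where l1 = ≤-refl , ≤-trans 1≤v v≤M

  module TSSCPP {π : Triples} (π-tsscpp : IsTSSCPP M π) where

    box : InBox N π
    box = proj₁ (proj₁ π-tsscpp)

    private
      downClosed : IsDownClosed π
      downClosed = proj₂ (proj₁ π-tsscpp)

      symmetric : IsTotallySymmetric π
      symmetric = proj₁ (proj₂ π-tsscpp)

    swap₁₂ : ∀ x y z → π x y z ≡ π y x z
    swap₁₂ x y z = proj₁ (symmetric x y z)

    swap₂₃ : ∀ x y z → π x y z ≡ π x z y
    swap₂₃ x y z = proj₁ (proj₂ (symmetric x y z))

    swap₁₃ : ∀ x y z → π x y z ≡ π z y x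
    swap₁₃ x y z = proj₁ (proj₂ (proj₂ (symmetric x y z)))

    rotate : ∀ x y z → π x y z ≡ π y z x
    rotate x y z = proj₁ (proj₂ (proj₂ (proj₂ (symmetric x y z))))

    complement : ∀ {x y z} → InCube x y z → π x y z ≡ not (π (co x) (co y) (co z))
    complement ((1≤x , x≤N) , (1≤y , y≤N) , (1≤z , z≤N)) =
      proj₂ (proj₂ π-tsscpp) _ _ _ 1≤x x≤N 1≤y y≤N 1≤z z≤N

    lowerʸ : ∀ {x y₁ y₂ z} → 1 ≤ y₁ → y₁ ≤ y₂ → π x y₂ z ≡ true → π x y₁ z ≡ true
    lowerʸ {x} {y₁} {y₂} {z} 1≤y₁ y₁≤y₂ e =
      let (x∈ , _ , z∈) = box x y₂ z e in
      downClosed x y₁ z x y₂ z e (proj₁ x∈) 1≤y₁ (proj₁ z∈) ≤-refl y₁≤y₂ ≤-refl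

    fibre-downClosed : ∀ x y → DownClosed (π x y)
    fibre-downClosed x y {z₁} {z₂} 1≤z₁ z₁≤z₂ e =
      let (x∈ , y∈ , _) = box x y z₂ e in
      downClosed x y z₁ x y z₂ e (proj₁ x∈) (proj₁ y∈) 1≤z₁ ≤-refl ≤-refl z₁≤z₂

    ∈⇔≤height : ∀ x y {z} → z ∈[ N ] → π x y z ≡ true ⇔ z ≤ heights N π x y
    ∈⇔≤height x y = countUpTo-downClosed (fibre-downClosed x y) N

    ∈-co-diagonal : ∀ {x y} → x ∈[ N ] → Low y → π x y (co x) ≡ true
    ∈-co-diagonal {x} {y} x∈@(_ , x≤N) ly@(1≤y , y≤M) =
      ≡not⇒true (complement (x∈ , Low⇒∈ ly , co-∈ x∈)) λ e →
        lowerʸ 1≤y (<⇒≤ (<-≤-trans (s≤s y≤M) (proj₁ (co-Low ly))))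
          (trans (swap₁₃ x (co y) (co x))
                 (subst (λ w → π (co x) (co y) w ≡ true) (co-involutive (m≤n⇒m≤1+n x≤N)) e))

    isHeightArray : IsHeightArray (heights N π)
    isHeightArray = record
      { symmetric = λ u v → countUpTo-cong N (swap₁₂ u v)
      ; antitone  = λ _ (1≤v , _) _ → countUpTo-mono N (lowerʸ 1≤v (n≤1+n _))
      ; bounded   = λ _ _ → countUpTo-≤ (π _ _) N
      ; co≤       = λ {u} {v} lu lv →
                      to (∈⇔≤height u v (co-∈ (Low⇒∈ lu))) (∈-co-diagonal (Low⇒∈ lu) lv)
      }

  tsscpp-unique : ∀ {π π′} → IsTSSCPP M π → IsTSSCPP M π′ →
                  (∀ {x y} → Low x → Low y → heights N π x y ≡ heights N π′ x y) →
                  ∀ x y z → π x y z ≡ π′ x y z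
  tsscpp-unique {π} {π′} t t′ sameHeights x y z =
    ≡-from-⇔ (mk⇔ (λ e → trans (sym (inCube (T.box x y z e))) e)
                  (λ e → trans (inCube (T′.box x y z e)) e))
    where
    module T  = TSSCPP t
    module T′ = TSSCPP t′
    lowPair : ∀ {x y z} → Low x → Low y → z ∈[ N ] → π x y z ≡ π′ x y z
    lowPair {x} {y} {z} lx ly z∈ = ≡-from-⇔ (⇔-sym (T′.∈⇔≤height x y z∈) ⇔-∘
      subst (λ h → π x y z ≡ true ⇔ z ≤ h) (sameHeights lx ly) (T.∈⇔≤height x y z∈))
    twoLow : ∀ {x y z} → InCube x y z → AtLeastTwo Low x y z → π x y z ≡ π′ x y z
    twoLow (_ , _ , z∈) (inj₁ (lx , ly)) = lowPair lx ly z∈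
    twoLow {x} {y} {z} (_ , y∈ , _) (inj₂ (inj₁ (lx , lz))) =
      trans (T.swap₂₃ x y z) (trans (lowPair lx lz y∈) (sym (T′.swap₂₃ x y z)))
    twoLow {x} {y} {z} (x∈ , _ , _) (inj₂ (inj₂ (ly , lz))) =
      trans (T.rotate x y z) (trans (lowPair ly lz x∈) (sym (T′.rotate x y z)))
    inCube : ∀ {x y z} → InCube x y z → π x y z ≡ π′ x y z
    inCube c@(x∈ , y∈ , z∈) with twoLow⊎twoHigh c
    ... | inj₁ two = twoLow c two
    ... | inj₂ two = trans (T.complement c)
      (trans (cong not (twoLow (co-∈ x∈ , co-∈ y∈ , co-∈ z∈) (co-twoHigh two)))
             (sym (T′.complement c)))

  module FromHeightArray {A : ℕ → ℕ → ℕ} (isA : IsHeightArray A) where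
    open IsHeightArray isA

    private
      -- A point with two coordinates ≤ M lies in π iff its third coordinate is at most the
      -- height of that pair; every other point is decided by self-complementarity.
      fill : Bool → Bool → Bool → ℕ → ℕ → ℕ → Bool
      fill true  true  true  x y z = true
      fill true  true  false x y z = z ≤ᵇ A x y
      fill true  false true  x y z = y ≤ᵇ A x z
      fill false true  true  x y z = x ≤ᵇ A y z
      fill true  false false x y z = not (co x ≤ᵇ A (co y) (co z))
      fill false true  false x y z = not (co y ≤ᵇ A (co x) (co z))
      fill false false true  x y z = not (co z ≤ᵇ A (co x) (co y))
      fill false false false x y z = false

      inRange low : ℕ → Bool
      inRange x = (1 ≤ᵇ x) ∧ (x ≤ᵇ N)
      low x = x ≤ᵇ M

    π : Triples
    π x y z = (inRange x ∧ inRange y ∧ inRange z) ∧ fill (low x) (low y) (low z) x y z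

    private
      inRange⇔ : ∀ {x} → inRange x ≡ true ⇔ x ∈[ N ]
      inRange⇔ = mk⇔ (λ eq → let (1≤x , x≤N) = ∧-≡-true eq in to ≤ᵇ⇔≤ 1≤x , to ≤ᵇ⇔≤ x≤N)
                     (λ (1≤x , x≤N) → cong₂ _∧_ (from ≤ᵇ⇔≤ 1≤x) (from ≤ᵇ⇔≤ x≤N))

      low-true : ∀ {x} → Low x → low x ≡ true
      low-true (_ , x≤M) = from ≤ᵇ⇔≤ x≤M

      low-false : ∀ {x} → High x → low x ≡ false
      low-false (M<x , _) = ≤ᵇ-false M<x

      low-co : ∀ {x} → x ∈[ N ] → low (co x) ≡ not (low x)
      low-co x∈ with Low⊎High x∈
      ... | inj₁ lx rewrite low-true lx  = low-false (co-Low lx)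
      ... | inj₂ hx rewrite low-false hx = low-true (co-High hx)

      π-zones : ∀ {x y z a b c} → InCube x y z → low x ≡ a → low y ≡ b → low z ≡ c →
                π x y z ≡ fill a b c x y z
      π-zones (x∈ , y∈ , z∈) refl refl refl
        rewrite from inRange⇔ x∈ | from inRange⇔ y∈ | from inRange⇔ z∈ = refl

      fill-swap₁₂ : ∀ a b c x y z → fill a b c x y z ≡ fill b a c y x z
      fill-swap₁₂ true  true  true  x y z = refl
      fill-swap₁₂ true  true  false x y z = cong (z ≤ᵇ_) (symmetric x y)
      fill-swap₁₂ true  false true  x y z = refl
      fill-swap₁₂ false true  true  x y z = refl
      fill-swap₁₂ true  false false x y z = refl
      fill-swap₁₂ false true  false x y z = refl
      fill-swap₁₂ false false true  x y z = cong (λ h → not (co z ≤ᵇ h)) (symmetric (co x) (co y))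
      fill-swap₁₂ false false false x y z = refl

      fill-swap₂₃ : ∀ a b c x y z → fill a b c x y z ≡ fill a c b x z y
      fill-swap₂₃ true  true  true  x y z = refl
      fill-swap₂₃ true  true  false x y z = refl
      fill-swap₂₃ true  false true  x y z = refl
      fill-swap₂₃ false true  true  x y z = cong (x ≤ᵇ_) (symmetric y z)
      fill-swap₂₃ true  false false x y z = cong (λ h → not (co x ≤ᵇ h)) (symmetric (co y) (co z))
      fill-swap₂₃ false true  false x y z = refl
      fill-swap₂₃ false false true  x y z = refl
      fill-swap₂₃ false false false x y z = refl

      fill-complement : ∀ a b c x y z → co (co x) ≡ x → co (co y) ≡ y → co (co z) ≡ z →
        fill a b c x y z ≡ not (fill (not a) (not b) (not c) (co x) (co y) (co z))
      fill-complement true  true  true  x y z _  _  _  = refl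
      fill-complement true  true  false x y z cx cy cz rewrite cx | cy | cz = sym (not-involutive _)
      fill-complement true  false true  x y z cx cy cz rewrite cx | cy | cz = sym (not-involutive _)
      fill-complement false true  true  x y z cx cy cz rewrite cx | cy | cz = sym (not-involutive _)
      fill-complement true  false false x y z _  _  _  = refl
      fill-complement false true  false x y z _  _  _  = refl
      fill-complement false false true  x y z _  _  _  = refl
      fill-complement false false false x y z _  _  _  = refl

    π-box : InBox N π
    π-box x y z eq =
      let (xyz , _) = ∧-≡-true eq ; (x∈ , yz) = ∧-≡-true xyz ; (y∈ , z∈) = ∧-≡-true yz
      in to inRange⇔ x∈ , to inRange⇔ y∈ , to inRange⇔ z∈

    π-swap₁₂ : ∀ x y z → π x y z ≡ π y x z
    π-swap₁₂ x y z = cong₂ _∧_ (∧-swapˡ (inRange x) (inRange y) (inRange z))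
                               (fill-swap₁₂ (low x) (low y) (low z) x y z)
      where
      ∧-swapˡ : ∀ a b c → a ∧ (b ∧ c) ≡ b ∧ (a ∧ c)
      ∧-swapˡ a b c =
        trans (sym (∧-assoc a b c)) (trans (cong (_∧ c) (∧-comm a b)) (∧-assoc b a c))

    π-swap₂₃ : ∀ x y z → π x y z ≡ π x z y
    π-swap₂₃ x y z = cong₂ _∧_ (cong (inRange x ∧_) (∧-comm (inRange y) (inRange z)))
                               (fill-swap₂₃ (low x) (low y) (low z) x y z)

    π-complement : IsSelfComplementary N π
    π-complement x y z 1≤x x≤N 1≤y y≤N 1≤z z≤N = begin
      π x y z
        ≡⟨ π-zones (x∈ , y∈ , z∈) refl refl refl ⟩
      fill (low x) (low y) (low z) x y z
        ≡⟨ fill-complement (low x) (low y) (low z) x y z (co² x≤N) (co² y≤N) (co² z≤N) ⟩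
      not (fill (not (low x)) (not (low y)) (not (low z)) (co x) (co y) (co z))
        ≡⟨ cong not (π-zones (co-∈ x∈ , co-∈ y∈ , co-∈ z∈) (low-co x∈) (low-co y∈) (low-co z∈)) ⟨
      not (π (co x) (co y) (co z)) ∎
      where
      open ≡-Reasoning
      x∈ = 1≤x , x≤N
      y∈ = 1≤y , y≤N
      z∈ = 1≤z , z≤N
      co² : ∀ {w} → w ≤ N → co (co w) ≡ w
      co² w≤N = co-involutive (m≤n⇒m≤1+n w≤N)

    π-LLL : ∀ {x y z} → Low x → Low y → Low z → π x y z ≡ true
    π-LLL lx ly lz =
      π-zones (Low⇒∈ lx , Low⇒∈ ly , Low⇒∈ lz) (low-true lx) (low-true ly) (low-true lz)

    π-LLH⇔ : ∀ {x y z} → Low x → Low y → High z → π x y z ≡ true ⇔ z ≤ A x y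
    π-LLH⇔ lx ly hz
      rewrite π-zones (Low⇒∈ lx , Low⇒∈ ly , High⇒∈ hz) (low-true lx) (low-true ly) (low-false hz)
      = ≤ᵇ⇔≤

    π-LHH⇔ : ∀ {x y z} → Low x → High y → High z → π x y z ≡ true ⇔ A (co y) (co z) < co x
    π-LHH⇔ lx hy hz
      rewrite π-zones (Low⇒∈ lx , High⇒∈ hy , High⇒∈ hz) (low-true lx) (low-false hy) (low-false hz)
      = not-≤ᵇ⇔>

    π-HHH : ∀ {x y z} → High x → High y → High z → π x y z ≡ false
    π-HHH hx hy hz =
      π-zones (High⇒∈ hx , High⇒∈ hy , High⇒∈ hz) (low-false hx) (low-false hy) (low-false hz)

    π-LHL⇔ : ∀ {x y z} → Low x → High y → Low z → π x y z ≡ true ⇔ y ≤ A x z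
    π-LHL⇔ {x} {y} {z} lx hy lz rewrite π-swap₂₃ x y z = π-LLH⇔ lx lz hy

    π-HHL⇔ : ∀ {x y z} → High x → High y → Low z → π x y z ≡ true ⇔ A (co x) (co y) < co z
    π-HHL⇔ {x} {y} {z} hx hy lz rewrite π-swap₂₃ x y z | π-swap₁₂ x z y = π-LHH⇔ lz hx hy

    private
      step-LL : ∀ {x y z} → Low x → Low y → 1 ≤ z → z < N →
                π x y (suc z) ≡ true → π x y z ≡ true
      step-LL lx ly 1≤z z<N e with Low⊎High (1≤z , <⇒≤ z<N)
      ... | inj₁ lz           = π-LLL lx ly lz
      ... | inj₂ hz@(M<z , _) = from (π-LLH⇔ lx ly hz)
        (≤-trans (n≤1+n _) (to (π-LLH⇔ lx ly (m<n⇒m<1+n M<z , z<N)) e))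

      step-LH : ∀ {x y z} → Low x → High y → 1 ≤ z → z < N →
                π x y (suc z) ≡ true → π x y z ≡ true
      step-LH {x} {y} {z} lx hy 1≤z z<N e with <-cmp z M
      ... | tri< z<M _ _ = from (π-LHL⇔ lx hy lz)
        (≤-trans (to (π-LHL⇔ lx hy (s≤s z≤n , z<M)) e) (antitone lx lz z<M))
        where lz = 1≤z , <⇒≤ z<M
      -- Crossing the plane z = M: this is where the lower bound co u ≤ A u v is needed.
      ... | tri≈ _ refl _ = from (π-LHL⇔ lx hy lM) (<⇒≤ (<-≤-trans y<co[x] (co≤ lx lM)))
        where
        lM : Low M
        lM = ≤-trans (proj₁ lx) (proj₂ lx) , ≤-refl
        hM+1 : High (suc M)
        hM+1 = ≤-refl , z<N
        y<co[x] : y < co x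
        y<co[x] = ≤-<-trans
          (subst (_≤ A (co y) (co (suc M))) (co-involutive (m≤n⇒m≤1+n (proj₂ hy)))
                 (co≤ (co-High hy) (co-High hM+1)))
          (to (π-LHH⇔ lx hy hM+1) e)
      ... | tri> _ _ M<z = from (π-LHH⇔ lx hy hz) (≤-<-trans A-step (to (π-LHH⇔ lx hy hz+1) e))
        where
        hz : High z
        hz = M<z , <⇒≤ z<N
        hz+1 : High (suc z)
        hz+1 = m<n⇒m<1+n M<z , z<N
        co-z : co z ≡ suc (co (suc z))
        co-z = co-suc (<⇒≤ z<N)
        A-step : A (co y) (co z) ≤ A (co y) (co (suc z))
        A-step = subst (λ w → A (co y) w ≤ A (co y) (co (suc z))) (sym co-z)
          (antitone (co-High hy) (co-High hz+1) (subst (_≤ M) co-z (proj₂ (co-High hz))))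

      step-HH : ∀ {x y z} → High x → High y → 1 ≤ z → z < N →
                π x y (suc z) ≡ true → π x y z ≡ true
      step-HH {z = z} hx hy 1≤z z<N e with suc z ≤? M
      ... | yes z<M = from (π-HHL⇔ hx hy (1≤z , <⇒≤ z<M))
        (<-≤-trans (to (π-HHL⇔ hx hy (s≤s z≤n , z<M)) e) (co-antitone (n≤1+n z)))
      ... | no  z≮M with () ← trans (sym e) (π-HHH hx hy (≰⇒> z≮M , z<N))

    π-step : ∀ x y z → 1 ≤ z → π x y (suc z) ≡ true → π x y z ≡ true
    π-step x y z 1≤z e with π-box x y (suc z) e
    ... | x∈ , y∈ , (_ , z<N) with Low⊎High x∈ | Low⊎High y∈
    ... | inj₁ lx | inj₁ ly = step-LL lx ly 1≤z z<N e
    ... | inj₁ lx | inj₂ hy = step-LH lx hy 1≤z z<N e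
    ... | inj₂ hx | inj₁ ly = trans (π-swap₁₂ x y z)
                                (step-LH ly hx 1≤z z<N (trans (sym (π-swap₁₂ x y (suc z))) e))
    ... | inj₂ hx | inj₂ hy = step-HH hx hy 1≤z z<N e

    π-tsscpp : IsTSSCPP M π
    π-tsscpp = (π-box , FromSwaps.downClosed-from-steps π-swap₁₂ π-swap₂₃ π-step) ,
               FromSwaps.totallySymmetric π-swap₁₂ π-swap₂₃ , π-complement

    heights-π : ∀ {x y} → Low x → Low y → heights N π x y ≡ A x y
    heights-π {x} {y} lx ly = trans (countUpTo-initial N spec) (m≤n⇒m⊓n≡m (bounded lx ly))
      where
      spec : ∀ {z} → z ∈[ N ] → π x y z ≡ true ⇔ z ≤ A x y
      spec z∈ with Low⊎High z∈
      ... | inj₁ lz@(_ , z≤M) =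
        mk⇔ (λ _ → <⇒≤ (≤-<-trans z≤M (<-≤-trans (proj₁ (co-Low lx)) (co≤ lx ly))))
            (λ _ → π-LLL lx ly lz)
      ... | inj₂ hz = π-LLH⇔ lx ly hz

  module _ {A A′ : ℕ → ℕ → ℕ} (isA : IsHeightArray A) (isA′ : IsHeightArray A′)
           (agree : ∀ {u v} → 2 ≤ u → u ≤ v → v ≤ M → A u v ≡ A′ u v) where
    private
      module A  = IsHeightArray isA
      module A′ = IsHeightArray isA′

      agreeOrdered : ∀ {u v} → Low u → u ≤ v → Low v → A u v ≡ A′ u v
      agreeOrdered {suc zero}    _ _   lv         = trans (A.firstRow lv) (sym (A′.firstRow lv))
      agreeOrdered {suc (suc _)} _ u≤v (_ , v≤M) = agree (s≤s (s≤s z≤n)) u≤v v≤M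

    heightArrays-agree : ∀ {u v} → Low u → Low v → A u v ≡ A′ u v
    heightArrays-agree {u} {v} lu lv with ≤-total u v
    ... | inj₁ u≤v = agreeOrdered lu u≤v lv
    ... | inj₂ v≤u =
      trans (A.symmetric u v) (trans (agreeOrdered lv v≤u lu) (sym (A′.symmetric u v)))

  record IsUpperHeightArray (f : ℕ → ℕ → ℕ) : Set where
    field
      antitoneʳ : ∀ {u v} → InTri M u v → suc v ≤ M → f u (suc v) ≤ f u v
      antitoneˡ : ∀ {u v} → InTri M u v → suc u ≤ v → f (suc u) v ≤ f u v
      bounded   : ∀ {u v} → InTri M u v → f u v ≤ N
      co≤       : ∀ {u v} → InTri M u v → co u ≤ f u v

  symmetrize-isHeightArray : ∀ {f} → IsUpperHeightArray f → IsHeightArray (symmetrize f)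
  symmetrize-isHeightArray {f} isF = record
    { symmetric = symmetrize-sym f
    ; antitone  = sym-antitone
    ; bounded   = sym-bounded
    ; co≤       = sym-co≤
    }
    where
    open IsUpperHeightArray isF
    sym-antitone : ∀ {u v} → Low u → Low v → suc v ≤ M →
                   symmetrize f u (suc v) ≤ symmetrize f u v
    sym-antitone {u} {v} (1≤u , u≤M) (1≤v , _) v<M with u ≤? v
    ... | yes u≤v = subst₂ _≤_ (sym (symmetrize-≤ f (m≤n⇒m≤1+n u≤v))) (sym (symmetrize-≤ f u≤v))
                      (antitoneʳ (1≤u , u≤v , <⇒≤ v<M) v<M)
    ... | no  u≰v = subst₂ _≤_ (sym (symmetrize-≥ f v<u)) (sym (symmetrize-≥ f (<⇒≤ v<u)))
                      (antitoneˡ (1≤v , <⇒≤ v<u , u≤M) v<u)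
      where v<u = ≰⇒> u≰v
    sym-bounded : ∀ {u v} → Low u → Low v → symmetrize f u v ≤ N
    sym-bounded {u} {v} (1≤u , u≤M) (1≤v , v≤M) with ≤-total u v
    ... | inj₁ u≤v = subst (_≤ N) (sym (symmetrize-≤ f u≤v)) (bounded (1≤u , u≤v , v≤M))
    ... | inj₂ v≤u = subst (_≤ N) (sym (symmetrize-≥ f v≤u)) (bounded (1≤v , v≤u , u≤M))
    sym-co≤ : ∀ {u v} → Low u → Low v → co u ≤ symmetrize f u v
    sym-co≤ {u} {v} (1≤u , u≤M) (1≤v , v≤M) with ≤-total u v
    ... | inj₁ u≤v = subst (co u ≤_) (sym (symmetrize-≤ f u≤v)) (co≤ (1≤u , u≤v , v≤M))
    ... | inj₂ v≤u = subst (co u ≤_) (sym (symmetrize-≥ f v≤u))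
                       (≤-trans (co-antitone v≤u) (co≤ (1≤v , v≤u , u≤M)))

2[n+m]≡[n+2m]+n : ∀ n m → 2 * (n + m) ≡ (n + 2 * m) + n
2[n+m]≡[n+2m]+n = solve-∀

+m-+n≡+[m∸n] : ∀ {m n} → n ≤ m → + m ℤ.- + n ≡ + (m ∸ n)
+m-+n≡+[m∸n] {m} {n} n≤m = trans (ℤ.m-n≡m⊖n m n) (ℤ.⊖-≥ n≤m)

≤∸1⇒< : ∀ {j k} → 1 ≤ j → j ≤ k ∸ 1 → j < k
≤∸1⇒< {k = zero}  1≤j j≤0 = ⊥-elim (<⇒≱ 1≤j j≤0)
≤∸1⇒< {k = suc k} _   j≤k = s≤s j≤k

module Correspondence (n m : ℕ) where
  open Cube (n + m) public

  M K offset : ℕ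
  M = n + m
  K = M ∸ 1
  offset = n + 2 * m

  N≡offset+n : N ≡ offset + n
  N≡offset+n = 2[n+m]≡[n+2m]+n n m

  offset≤N : offset ≤ N
  offset≤N = subst (offset ≤_) (sym N≡offset+n) (m≤m+n offset n)

  M≤offset : M ≤ offset
  M≤offset = +-monoʳ-≤ n (m≤m+n m (m + 0))

  co[1+n]≡offset : co (suc n) ≡ offset
  co[1+n]≡offset = trans (cong (_∸ n) N≡offset+n) (m+n∸n≡m offset n)

  co-offset : co offset ≡ suc n
  co-offset = trans (cong co (sym co[1+n]≡offset))
                    (co-involutive (s≤s (subst (n ≤_) (sym N≡offset+n) (m≤n+m n offset))))

  offset≤co : ∀ {x} → x ≤ suc n → offset ≤ co x
  offset≤co {x} x≤n+1 = subst (_≤ co x) co[1+n]≡offset (co-antitone x≤n+1)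

  co≤offset : ∀ {x} → suc n ≤ x → co x ≤ offset
  co≤offset {x} n+1≤x = subst (co x ≤_) co[1+n]≡offset (co-antitone n+1≤x)

  co[1+i]⊔offset : ∀ i → co (suc i) ⊔ offset ≡ offset + (n ∸ i)
  co[1+i]⊔offset i with i ≤? n
  ... | yes i≤n = trans (m≥n⇒m⊔n≡m (subst (offset ≤_) (sym co[1+i]) (m≤m+n offset (n ∸ i))))
                        co[1+i]
    where
    co[1+i] : co (suc i) ≡ offset + (n ∸ i)
    co[1+i] = trans (cong (_∸ i) N≡offset+n) (+-∸-assoc offset i≤n)
  ... | no  i≰n = begin
    co (suc i) ⊔ offset ≡⟨ m≤n⇒m⊔n≡n (m≤n+o⇒m∸n≤o N i N≤i+offset) ⟩
    offset              ≡⟨ +-identityʳ offset ⟨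
    offset + 0          ≡⟨ cong (_+_ offset) (m≤n⇒m∸n≡0 n≤i) ⟨
    offset + (n ∸ i)    ∎
    where
    open ≡-Reasoning
    n≤i = <⇒≤ (≰⇒> i≰n)
    N≤i+offset : N ≤ i + offset
    N≤i+offset = subst (_≤ i + offset) (trans (+-comm n offset) (sym N≡offset+n))
                       (+-monoˡ-≤ offset n≤i)

  tri⇒low : ∀ {i j} → InTri K i j → Low (suc i) × Low (suc j)
  tri⇒low (1≤i , i≤j , j≤K) = (s≤s z≤n , ≤-trans (s≤s i≤j) j<M) , (s≤s z≤n , j<M)
    where j<M = ≤∸1⇒< (≤-trans 1≤i i≤j) j≤K

  ¬twoLe : ∀ {a b c} → M < a → M < b → AtLeastTwoLe M a b c → ⊥
  ¬twoLe M<a _   (inj₁ (a≤M , _))        = <⇒≱ M<a a≤M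
  ¬twoLe M<a _   (inj₂ (inj₁ (a≤M , _))) = <⇒≱ M<a a≤M
  ¬twoLe _   M<b (inj₂ (inj₂ (b≤M , _))) = <⇒≱ M<b b≤M

  heightArray⇒InT : ∀ {A} → IsHeightArray A → (∀ {u v} → Low u → Low v → offset ≤ A u v) →
                    InT n m (λ i j → + A (suc i) (suc j) ℤ.- + offset)
  heightArray⇒InT {A} isA offset≤A = rows , columns , bounds
    where
    open IsHeightArray isA
    b : ℕ → ℕ → ℤ
    b i j = + A (suc i) (suc j) ℤ.- + offset
    rows : ∀ i j → InTri K i j → InTri K i (suc j) → b i (suc j) ℤ.≤ b i j
    rows i j ij ij+1 = let (li , lj) = tri⇒low ij in
      ℤ.+-monoˡ-≤ (ℤ.- + offset) (ℤ.+≤+ (antitone li lj (proj₂ (proj₂ (tri⇒low ij+1)))))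
    columns : ∀ i j → InTri K i j → InTri K (suc i) j → b (suc i) j ℤ.≤ b i j
    columns i j ij i+1j = let (li , lj) = tri⇒low ij in
      ℤ.+-monoˡ-≤ (ℤ.- + offset) (ℤ.+≤+ (antitoneˡ li lj (proj₂ (proj₁ (tri⇒low i+1j)))))
    bounds : ∀ i j → InTri K i j → (+ (n ∸ i) ℤ.≤ b i j) × (b i j ℤ.≤ + n)
    bounds i j ij = subst (λ t → (+ (n ∸ i) ℤ.≤ t) × (t ℤ.≤ + n))
                          (sym (+m-+n≡+[m∸n] (offset≤A li lj))) (ℤ.+≤+ lower , ℤ.+≤+ upper)
      where
      li = proj₁ (tri⇒low ij)
      lj = proj₂ (tri⇒low ij)
      h = A (suc i) (suc j)
      lower : n ∸ i ≤ h ∸ offset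
      lower = m+n≤o⇒m≤o∸n (n ∸ i) (subst (_≤ h) (trans (co[1+i]⊔offset i) (+-comm offset (n ∸ i)))
                                              (⊔-lub (co≤ li lj) (offset≤A li lj)))
      upper : h ∸ offset ≤ n
      upper = m≤n+o⇒m∸n≤o h offset (subst (h ≤_) N≡offset+n (bounded li lj))

  module _ {π : Triples} (π∈S : InS n m π) where
    open TSSCPP (proj₁ π∈S)
    open IsHeightArray isHeightArray

    private
      offset≤heights-via-S : ∀ {x y} → Low x → Low y → suc n < x → suc n < y →
                             offset ≤ heights N π x y
      offset≤heights-via-S {x} {y} lx ly n+1<x n+1<y = to (∈⇔≤height x y offset∈)
        (≡not⇒true (complement (Low⇒∈ lx , Low⇒∈ ly , offset∈)) λ e → ⊥-elim
          (¬twoLe (proj₁ (co-Low lx)) (proj₁ (co-Low ly))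
            (proj₂ π∈S (co x) (co y) (co offset) e
              (n+1≤co lx) (co≤offset (<⇒≤ n+1<x)) (n+1≤co ly) (co≤offset (<⇒≤ n+1<y))
              (≤-reflexive (sym co-offset)) (subst (_≤ offset) (sym co-offset) n+1≤offset))))
        where
        n+1≤offset : suc n ≤ offset
        n+1≤offset = ≤-trans (<⇒≤ n+1<x) (≤-trans (proj₂ lx) M≤offset)
        offset∈ : offset ∈[ N ]
        offset∈ = ≤-trans (s≤s z≤n) n+1≤offset , offset≤N
        n+1≤co : ∀ {w} → Low w → suc n ≤ co w
        n+1≤co lw = ≤-trans (s≤s (m≤m+n n m)) (proj₁ (co-Low lw))

    offset≤heights : ∀ {x y} → Low x → Low y → offset ≤ heights N π x y
    offset≤heights {x} {y} lx ly with x ≤? suc n | y ≤? suc n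
    ... | yes x≤n+1 | _         = ≤-trans (offset≤co x≤n+1) (co≤ lx ly)
    ... | no  _     | yes y≤n+1 =
      subst (offset ≤_) (symmetric y x) (≤-trans (offset≤co y≤n+1) (co≤ ly lx))
    ... | no  x≰n+1 | no  y≰n+1 = offset≤heights-via-S lx ly (≰⇒> x≰n+1) (≰⇒> y≰n+1)

  module _ {A : ℕ → ℕ → ℕ} (isA : IsHeightArray A)
           (offset≤A : ∀ {u v} → Low u → Low v → offset ≤ A u v) where
    open FromHeightArray isA

    private
      π-∉ : ∀ {x y z} → suc n ≤ x → x ∈[ N ] → High y → High z → π x y z ≡ false
      π-∉ {x} n+1≤x x∈ hy hz with Low⊎High x∈
      ... | inj₂ hx = π-HHH hx hy hz
      ... | inj₁ lx = ¬-not λ e → <⇒≱ (to (π-LHH⇔ lx hy hz) e)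
        (≤-trans (co≤offset n+1≤x) (offset≤A (co-High hy) (co-High hz)))

    fromHeightArray-inS : InS n m π
    fromHeightArray-inS = π-tsscpp , S-condition
      where
      S-condition : ∀ x y z → π x y z ≡ true →
                    suc n ≤ x → x ≤ offset → suc n ≤ y → y ≤ offset → suc n ≤ z → z ≤ offset →
                    AtLeastTwoLe M x y z
      S-condition x y z e n+1≤x _ n+1≤y _ n+1≤z _ with π-box x y z e
      ... | c@(x∈ , y∈ , z∈) with twoLow⊎twoHigh c
      ... | inj₁ two = AtLeastTwo-map {Low} proj₂ two
      ... | inj₂ (inj₁ (hx , hy)) = ⊥-elim (not-¬ e
        (trans (π-swap₂₃ x y z) (trans (π-swap₁₂ x z y) (π-∉ n+1≤z z∈ hx hy))))
      ... | inj₂ (inj₂ (inj₁ (hx , hz))) = ⊥-elim (not-¬ e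
        (trans (π-swap₁₂ x y z) (π-∉ n+1≤y y∈ hx hz)))
      ... | inj₂ (inj₂ (inj₂ (hy , hz))) = ⊥-elim (not-¬ e (π-∉ n+1≤x x∈ hy hz))

  toTri-agree⇒heights-agree : ∀ {π π′} → IsTSSCPP M π → IsTSSCPP M π′ →
    (∀ i j → InTri K i j → toTri n m π i j ≡ toTri n m π′ i j) →
    ∀ {x y} → Low x → Low y → heights N π x y ≡ heights N π′ x y
  toTri-agree⇒heights-agree {π} {π′} t t′ sameTri =
    heightArrays-agree (TSSCPP.isHeightArray t) (TSSCPP.isHeightArray t′) agree
    where
    agree : ∀ {u v} → 2 ≤ u → u ≤ v → v ≤ M → heights N π u v ≡ heights N π′ u v
    agree {suc zero}    (s≤s ()) _ _
    agree {suc (suc _)} {zero}  _ () _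
    agree {suc (suc i)} {suc j} _ u≤v v≤M = ℤ.+-injective (∙-cancelʳ (ℤ.- + offset) _ _
      (sameTri (suc i) j (s≤s z≤n , ≤-pred u≤v , ∸-monoˡ-≤ 1 v≤M)))

  -- The inverse of toTri on 2 ≤ u ≤ v ≤ M; the first row is N, as firstRow forces.
  upperHeights : TriArray → ℕ → ℕ → ℕ
  upperHeights b (suc (suc i)) (suc j) = offset + ℤ.∣ b (suc i) j ∣
  upperHeights b _             _       = N

  offset≤upperHeights : ∀ b u v → offset ≤ upperHeights b u v
  offset≤upperHeights b (suc (suc i)) (suc j) = m≤m+n offset _
  offset≤upperHeights b (suc (suc i)) zero    = offset≤N
  offset≤upperHeights b (suc zero)    _       = offset≤N
  offset≤upperHeights b zero          _       = offset≤N

  module FromTri {b : TriArray} (b∈T : InT n m b) where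
    private
      ∣b∣ : ℕ → ℕ → ℕ
      ∣b∣ i j = ℤ.∣ b i j ∣

      +∣b∣≡b : ∀ {i j} → InTri K i j → + ∣b∣ i j ≡ b i j
      +∣b∣≡b ij = ℤ.0≤i⇒+∣i∣≡i (ℤ.≤-trans (ℤ.+≤+ z≤n) (proj₁ (proj₂ (proj₂ b∈T) _ _ ij)))

      ∣b∣-mono : ∀ {i j i′ j′} → InTri K i j → InTri K i′ j′ → b i j ℤ.≤ b i′ j′ →
                 ∣b∣ i j ≤ ∣b∣ i′ j′
      ∣b∣-mono ij i′j′ b≤b′ =
        ℤ.drop‿+≤+ (subst₂ ℤ._≤_ (sym (+∣b∣≡b ij)) (sym (+∣b∣≡b i′j′)) b≤b′)

      ∣b∣-bounds : ∀ {i j} → InTri K i j → n ∸ i ≤ ∣b∣ i j × ∣b∣ i j ≤ n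
      ∣b∣-bounds ij = let (lower , upper) = proj₂ (proj₂ b∈T) _ _ ij in
        ℤ.drop‿+≤+ (subst (_ ℤ.≤_) (sym (+∣b∣≡b ij)) lower) ,
        ℤ.drop‿+≤+ (subst (ℤ._≤ _) (sym (+∣b∣≡b ij)) upper)

      shift : ∀ {i j} → InTri M (suc (suc i)) (suc j) → InTri K (suc i) j
      shift (_ , s≤s i+1≤j , j+1≤M) = s≤s z≤n , i+1≤j , ∸-monoˡ-≤ 1 j+1≤M

    isUpperHeightArray : IsUpperHeightArray (upperHeights b)
    isUpperHeightArray = record
      { antitoneʳ = rows ; antitoneˡ = columns ; bounded = bounded ; co≤ = co≤ }
      where
      bounded : ∀ {u v} → InTri M u v → upperHeights b u v ≤ N
      bounded {suc zero}                _  = ≤-refl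
      bounded {suc (suc i)} {suc j}     uv =
        subst (offset + ∣b∣ (suc i) j ≤_) (sym N≡offset+n)
              (+-monoʳ-≤ offset (proj₂ (∣b∣-bounds (shift uv))))
      bounded {suc (suc _)} {zero} (_ , () , _)

      rows : ∀ {u v} → InTri M u v → suc v ≤ M → upperHeights b u (suc v) ≤ upperHeights b u v
      rows {suc zero}    _ _ = ≤-refl
      rows {suc (suc i)} {suc j} uv@(_ , u≤v , _) j+2≤M = +-monoʳ-≤ offset
        (∣b∣-mono (shift uv′) (shift uv) (proj₁ b∈T (suc i) j (shift uv) (shift uv′)))
        where uv′ = s≤s z≤n , m≤n⇒m≤1+n u≤v , j+2≤M
      rows {suc (suc _)} {zero} (_ , () , _) _

      columns : ∀ {u v} → InTri M u v → suc u ≤ v → upperHeights b (suc u) v ≤ upperHeights b u v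
      columns {suc zero}    (_ , _ , v≤M) 2≤v = bounded (s≤s z≤n , 2≤v , v≤M)
      columns {suc (suc i)} {suc j} uv@(_ , _ , v≤M) u<v = +-monoʳ-≤ offset
        (∣b∣-mono (shift uv′) (shift uv) (proj₁ (proj₂ b∈T) (suc i) j (shift uv) (shift uv′)))
        where uv′ = s≤s z≤n , u<v , v≤M
      columns {suc (suc _)} {zero} (_ , () , _) _

      co≤ : ∀ {u v} → InTri M u v → co u ≤ upperHeights b u v
      co≤ {suc zero}    _          = ≤-refl
      co≤ {suc (suc i)} {suc j} uv = ≤-trans (m≤m⊔n (co (suc (suc i))) offset)
        (subst (_≤ offset + ∣b∣ (suc i) j) (sym (co[1+i]⊔offset (suc i)))
               (+-monoʳ-≤ offset (proj₁ (∣b∣-bounds (shift uv)))))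
      co≤ {suc (suc _)} {zero} (_ , () , _)

    isHeightArray : IsHeightArray (symmetrize (upperHeights b))
    isHeightArray = symmetrize-isHeightArray isUpperHeightArray

    π : Triples
    π = FromHeightArray.π isHeightArray

    π-inS : InS n m π
    π-inS = fromHeightArray-inS isHeightArray λ {u} {v} _ _ → offset≤symmetrized u v
      where
      offset≤symmetrized : ∀ u v → offset ≤ symmetrize (upperHeights b) u v
      offset≤symmetrized u v with u ≤ᵇ v
      ... | true  = offset≤upperHeights b u v
      ... | false = offset≤upperHeights b v u

    toTri-π : ∀ i j → InTri K i j → toTri n m π i j ≡ b i j
    toTri-π zero    _ (() , _)
    toTri-π (suc i) j ij@(_ , i≤j , _) = begin
      + heights N π (suc (suc i)) (suc j) ℤ.- + offset
        ≡⟨ cong (λ h → + h ℤ.- + offset) (FromHeightArray.heights-π isHeightArray li lj) ⟩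
      + symmetrize (upperHeights b) (suc (suc i)) (suc j) ℤ.- + offset
        ≡⟨ cong (λ h → + h ℤ.- + offset) (symmetrize-≤ (upperHeights b) (s≤s i≤j)) ⟩
      + (offset + ∣b∣ (suc i) j) ℤ.- + offset
        ≡⟨ +m-+n≡+[m∸n] (m≤m+n offset _) ⟩
      + (offset + ∣b∣ (suc i) j ∸ offset)
        ≡⟨ cong +_ (m+n∸m≡n offset _) ⟩
      + ∣b∣ (suc i) j
        ≡⟨ +∣b∣≡b ij ⟩
      b (suc i) j ∎
      where
      open ≡-Reasoning
      li = proj₁ (tri⇒low ij)
      lj = proj₂ (tri⇒low ij)

theorem3p4 : (n m : ℕ) → 1 ≤ n →
    ((π : Triples) → InS n m π → InT n m (toTri n m π)) ×
    ((π π′ : Triples) → InS n m π → InS n m π′ →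
       (∀ i j → InTri (n + m ∸ 1) i j → toTri n m π i j ≡ toTri n m π′ i j) →
       ∀ x y z → π x y z ≡ π′ x y z) ×
    ((b : TriArray) → InT n m b →
       Σ Triples (λ π → InS n m π ×
         (∀ i j → InTri (n + m ∸ 1) i j → toTri n m π i j ≡ b i j)))
-- The argument does not need 1 ≤ n.
theorem3p4 n m _ =
  (λ π π∈S → heightArray⇒InT (TSSCPP.isHeightArray (proj₁ π∈S)) (offset≤heights π∈S)) ,
  (λ π π′ π∈S π′∈S sameTri → tsscpp-unique (proj₁ π∈S) (proj₁ π′∈S)
     (toTri-agree⇒heights-agree (proj₁ π∈S) (proj₁ π′∈S) sameTri)) ,
  (λ b b∈T → FromTri.π b∈T , FromTri.π-inS b∈T , FromTri.toTri-π b∈T)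
  where open Correspondence n m
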